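{- For every base $\mathcal{B}$, atomic multiset $L$, multiset of formulae $\Gamma$ and formula $\varphi$: if $\Gamma\Vdash^{L}_{\mathcal{B}}\varphi$, then $\Gamma\Vdash^{L}_{\mathcal{C}}\varphi$ for every base $\mathcal{C}\supseteq\mathcal{B}$.
   Context: Fix a set $\mathbb{A}$ of propositional atoms. All multisets are finite; $\uplus$ denotes multiset union; an atomic multiset is a finite multiset of atoms. Formulae: $\varphi ::= p\in\mathbb{A}\mid\top\mid 0\mid 1\mid\varphi\multimap\varphi\mid\varphi\otimes\varphi\mid\varphi\mathbin{\&}\varphi\mid\varphi\oplus\varphi\mid\,!\varphi$. Bases. An atomic sequent is a pair $P\Rightarrow p$ ($P$ atomic multiset, $p$ atom); an atomic box is a finite multiset of atomic sequents; an atomic rule is a triple $\langle\mathbf{A},\mathbf{S},p\rangle$ with $\mathbf{A}$ a finite multiset of atomic boxes, $\mathbf{S}$ an atomic box, $p$ an atom. A base is a set of atomic rules; $\mathcal{C}\supseteq\mathcal{B}$ is set inclusion. An atom $p$ is persistent in $\mathcal{B}$ if $\mathcal{B}$ contains a rule $\langle\varnothing,\mathbf{S},p\rangle$ with $\mathbf{S}\neq\varnothing$. Derivability $P\vdash_{\mathcal{B}}p$ is the smallest relation closed under: (Ref) $\{p\}\vdash_{\mathcal{B}}p$; (App) if $\langle\mathbf{A},\mathbf{S},p\rangle\in\mathcal{B}$ with $\mathbf{A}=\{\mathbf{T}_1,\dots,\mathbf{T}_m\}$, and there are $n\ge m$, atomic multisets $C_1,\dots,C_n$ and a multiset $D=\{d_{m+1},\dots,d_n\}$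 of atoms persistent in $\mathcal{B}$ with $C_i\uplus Q\vdash_{\mathcal{B}}q$ for all $i\le m$ and $Q\Rightarrow q\in\mathbf{T}_i$, $C_j\vdash_{\mathcal{B}}d_j$ for all $m<j\le n$, and $D\uplus U\vdash_{\mathcal{B}}v$ for all $U\Rightarrow v\in\mathbf{S}$, then $C_1\uplus\dots\uplus C_n\vdash_{\mathcal{B}}p$. Support. For a base $\mathcal{B}$, atomic multiset $L$: (At) $\Vdash^L_{\mathcal{B}}p$ iff $L\vdash_{\mathcal{B}}p$; ($\multimap$) $\Vdash^L_{\mathcal{B}}\varphi\multimap\psi$ iff $\varphi\Vdash^L_{\mathcal{B}}\psi$; ($\otimes$) $\Vdash^L_{\mathcal{B}}\varphi\otimes\psi$ iff for all $\mathcal{C}\supseteq\mathcal{B}$, atomic multisets $K$, atoms $p$: if $\{\varphi,\psi\}\Vdash^K_{\mathcal{C}}p$ then $\Vdash^{L\uplus K}_{\mathcal{C}}p$; ($1$) $\Vdash^L_{\mathcal{B}}1$ iff for all $\mathcal{C}\supseteq\mathcal{B}$, $K$, $p$: if $\Vdash^K_{\mathcal{C}}p$ then $\Vdash^{L\uplus K}_{\mathcal{C}}p$; ($\mathbin{\&}$) $\Vdash^L_{\mathcal{B}}\varphi\mathbin{\&}\psi$ iff $\Vdash^L_{\mathcal{B}}\varphi$ and $\Vdash^L_{\mathcal{B}}\psi$; ($\oplus$) $\Vdash^L_{\mathcal{B}}\varphi\oplus\psi$ iff for all $\mathcal{C}\supseteq\mathcal{B}$, $K$, $p$: if $\varphi\Vdash^K_{\mathcal{C}}p$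 and $\psi\Vdash^K_{\mathcal{C}}p$ then $\Vdash^{L\uplus K}_{\mathcal{C}}p$; ($0$) $\Vdash^L_{\mathcal{B}}0$ iff $\Vdash^{L\uplus K}_{\mathcal{B}}p$ for all atoms $p$ and atomic multisets $K$; ($\top$) $\Vdash^L_{\mathcal{B}}\top$ always; ($!$) $\Vdash^L_{\mathcal{B}}\,!\varphi$ iff for all $\mathcal{C}\supseteq\mathcal{B}$, $K$, $p$: if (for all $\mathcal{D}\supseteq\mathcal{C}$, $\Vdash^{\varnothing}_{\mathcal{D}}\varphi$ implies $\Vdash^K_{\mathcal{D}}p$) then $\Vdash^{L\uplus K}_{\mathcal{C}}p$. Multisets: $\Vdash^L_{\mathcal{B}}\varnothing$ iff $L=\varnothing$; $\Vdash^L_{\mathcal{B}}\{\varphi\}$ iff $\Vdash^L_{\mathcal{B}}\varphi$; $\Vdash^L_{\mathcal{B}}\Gamma\uplus\Delta$ iff $L=K\uplus M$ for some $K,M$ with $\Vdash^K_{\mathcal{B}}\Gamma$, $\Vdash^M_{\mathcal{B}}\Delta$. (Inf) For non-empty $\Gamma$, write $\Gamma=\,!\Delta\uplus\Theta$ with $!\Delta$ the elements whose top-level connective is $!$ and $\Theta$ the rest; $\Gamma\Vdash^L_{\mathcal{B}}\varphi$ iff for all $\mathcal{C}\supseteq\mathcal{B}$ and atomic $K$: if $\Vdash^{\varnothing}_{\mathcal{C}}\delta$ for every $\delta\in\Delta$ and $\Vdash^K_{\mathcal{C}}\Theta$, then $\Vdash^{L\uplus K}_{\mathcal{C}}\varphi$.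 For $\Gamma=\varnothing$, $\Gamma\Vdash^L_{\mathcal{B}}\varphi$ means $\Vdash^L_{\mathcal{B}}\varphi$. -}

module Defs where

open import Level using (Lift)
open import Data.Unit using (⊤)
open import Data.Product using (Σ; ∃; ∃-syntax; _×_; _,_; proj₁; proj₂)
open import Data.List using (List; []; _∷_; _++_; concat; map)
open import Data.List.Relation.Unary.All using (All)
open import Data.List.Relation.Binary.Pointwise using (Pointwise)
open import Data.List.Relation.Binary.Permutation.Propositional using (_↭_)
open import Relation.Binary.PropositionalEquality using (_≡_; _≢_)

-- Finite multisets are represented by lists; multiset union is _++_ and
-- multiset equality is permutation _↭_.

record Sequent (Atom : Set) : Set where
  constructor _⇒_
  field
    ante : List Atom
    succ : Atom

Box : Set → Set
Box Atom = List (Sequent Atom)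

record Rule (Atom : Set) : Set where
  constructor ⟨_,_,_⟩
  field
    prems : List (Box Atom)
    disch : Box Atom
    concl : Atom

Base : Set → Set₁
Base Atom = Rule Atom → Set

-- Base extension  𝓒 ⊇ 𝓑  written  𝓑 ⊑ 𝓒
_⊑_ : {Atom : Set} → Base Atom → Base Atom → Set
B ⊑ C = ∀ r → B r → C r

data Formula (Atom : Set) : Set where
  atom : Atom → Formula Atom
  ⊤f   : Formula Atom
  𝟎    : Formula Atom
  𝟏    : Formula Atom
  _⊸_  : Formula Atom → Formula Atom → Formula Atom
  _⊗_  : Formula Atom → Formula Atom → Formula Atom
  _&_  : Formula Atom → Formula Atom → Formula Atom
  _⊕_  : Formula Atom → Formula Atom → Formula Atom
  !_   : Formula Atom → Formula Atom

module _ {Atom : Set} where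

  Persistent : Base Atom → Atom → Set
  Persistent B p = Σ (Box Atom) λ S → (S ≢ []) × B ⟨ [] , S , p ⟩

  data Derives (B : Base Atom) : List Atom → Atom → Set where
    ref : ∀ {p} → Derives B (p ∷ []) p
    app : ∀ {L} (A : List (Box Atom)) (S : Box Atom) (p : Atom) → B ⟨ A , S , p ⟩ →
          -- C_1 … C_m, one per premise box T_i
          (Cs : List (List Atom)) →
          Pointwise (λ C T → All (λ s → Derives B (C ++ Sequent.ante s) (Sequent.succ s)) T) Cs A →
          -- C_{m+1} … C_n together with the persistent atoms d_{m+1} … d_n
          (Ex : List (List Atom × Atom)) →
          All (λ cd → Persistent B (proj₂ cd) × Derives B (proj₁ cd) (proj₂ cd)) Ex →
          All (λ s → Derives B (map proj₂ Ex ++ Sequent.ante s) (Sequent.succ s)) S →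
          L ↭ (concat Cs ++ concat (map proj₁ Ex)) →
          Derives B L p

  mutual
    Supp : Base Atom → List Atom → Formula Atom → Set₁
    Supp B L (atom p) = Lift _ (Derives B L p)
    Supp B L ⊤f = Lift _ ⊤
    Supp B L 𝟎 = Lift _ (∀ (p : Atom) (K : List Atom) → Derives B (L ++ K) p)
    Supp B L 𝟏 = ∀ C → B ⊑ C → ∀ K p → Derives C K p → Derives C (L ++ K) p
    Supp B L (φ ⊸ ψ) = ∀ C → B ⊑ C → ∀ K → Hyp C K φ → Supp C (L ++ K) ψ
    Supp B L (φ ⊗ ψ) = ∀ C → B ⊑ C → ∀ K p →
      (∀ D → C ⊑ D → ∀ M →
         (Σ (List Atom) λ M₁ → Σ (List Atom) λ M₂ → (M ↭ (M₁ ++ M₂)) × Hyp D M₁ φ × Hyp D M₂ ψ) →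
         Derives D (K ++ M) p) →
      Derives C (L ++ K) p
    Supp B L (φ & ψ) = Supp B L φ × Supp B L ψ
    Supp B L (φ ⊕ ψ) = ∀ C → B ⊑ C → ∀ K p →
      (∀ D → C ⊑ D → ∀ M → Hyp D M φ → Derives D (K ++ M) p) →
      (∀ D → C ⊑ D → ∀ M → Hyp D M ψ → Derives D (K ++ M) p) →
      Derives C (L ++ K) p
    Supp B L (! φ) = ∀ C → B ⊑ C → ∀ K p →
      (∀ D → C ⊑ D → Supp D [] φ → Derives D K p) →
      Derives C (L ++ K) p

    Hyp : Base Atom → List Atom → Formula Atom → Set₁
    Hyp C K (! δ) = Σ (K ≡ []) λ _ → Supp C [] δ
    Hyp C K θ = Supp C K θ

  SuppMulti : Base Atom → List Atom → List (Formula Atom) → Set₁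
  SuppMulti B L [] = Lift _ (L ≡ [])
  SuppMulti B L (θ ∷ Θ) =
    Σ (List Atom) λ K → Σ (List Atom) λ M → (L ↭ (K ++ M)) × Supp B K θ × SuppMulti B M Θ

  bangs : List (Formula Atom) → List (Formula Atom)
  bangs [] = []
  bangs ((! δ) ∷ Γ) = δ ∷ bangs Γ
  bangs (_ ∷ Γ) = bangs Γ

  others : List (Formula Atom) → List (Formula Atom)
  others [] = []
  others ((! δ) ∷ Γ) = others Γ
  others (θ ∷ Γ) = θ ∷ others Γ

  -- Γ ⊩^L_𝓑 φ   (rule Inf, and plain support for Γ = ∅)
  Entails : Base Atom → List Atom → List (Formula Atom) → Formula Atom → Set₁
  Entails B L [] φ = Supp B L φ
  Entails B L Γ@(_ ∷ _) φ = ∀ C → B ⊑ C → ∀ K →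
    All (λ δ → Supp C [] δ) (bangs Γ) → SuppMulti C K (others Γ) → Supp C (L ++ K) φ

{-# OPTIONS --safe #-}
-- Atomic derivability is monotone because a derivation in 𝓑 only applies
-- rules of 𝓑, which are still rules of 𝓒 (and persistence is witnessed by a
-- rule as well).  Every non-atomic clause of support, as well as (Inf), is
-- either built from smaller supports (&) or already quantifies over all
-- extensions of the base, so it transfers along 𝓑 ⊑ 𝓒 by transitivity of ⊑.
module Submission where

open import Defs
open import Data.List using (List; []; _∷_; _++_)
open import Data.List.Relation.Unary.All using (All; []; _∷_)
open import Data.List.Relation.Binary.Pointwise using (Pointwise; []; _∷_)
open import Data.Product using (_×_; _,_; proj₁; proj₂)
open import Level using (lift; lower)

⊑-trans : ∀ {Atom : Set} {B C D : Base Atom} → B ⊑ C → C ⊑ D → B ⊑ D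
⊑-trans B⊑C C⊑D r r∈B = C⊑D r (B⊑C r r∈B)

BoxDerives : ∀ {Atom : Set} → Base Atom → List Atom → Box Atom → Set
BoxDerives B X T = All (λ s → Derives B (X ++ Sequent.ante s) (Sequent.succ s)) T

module _ {Atom : Set} {B C : Base Atom} (B⊑C : B ⊑ C) where

  Persistent-mono : ∀ {p} → Persistent B p → Persistent C p
  Persistent-mono (S , S≢[] , r∈B) = S , S≢[] , B⊑C _ r∈B

  -- The helpers spell out All.map and Pointwise.map so that the termination
  -- checker sees the recursion into subderivations as structural.
  mutual
    Derives-mono : ∀ {L p} → Derives B L p → Derives C L p
    Derives-mono ref = ref
    Derives-mono (app A S p r∈B Cs premises Ex persistents discharged L↭) =
      app A S p (B⊑C _ r∈B) Cs (premises-mono premises)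
          Ex (persistents-mono persistents) (BoxDerives-mono discharged) L↭

    BoxDerives-mono : ∀ {X T} → BoxDerives B X T → BoxDerives C X T
    BoxDerives-mono []       = []
    BoxDerives-mono (d ∷ ds) = Derives-mono d ∷ BoxDerives-mono ds

    premises-mono : ∀ {Cs A} → Pointwise (BoxDerives B) Cs A → Pointwise (BoxDerives C) Cs A
    premises-mono []       = []
    premises-mono (d ∷ ds) = BoxDerives-mono d ∷ premises-mono ds

    persistents-mono : ∀ {Ex : List (List Atom × Atom)} →
      All (λ cd → Persistent B (proj₂ cd) × Derives B (proj₁ cd) (proj₂ cd)) Ex →
      All (λ cd → Persistent C (proj₂ cd) × Derives C (proj₁ cd) (proj₂ cd)) Ex
    persistents-mono []             = []
    persistents-mono ((p , d) ∷ ds) = (Persistent-mono p , Derives-mono d) ∷ persistents-mono ds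

Supp-mono : ∀ {Atom : Set} {B C : Base Atom} → B ⊑ C → ∀ {L} φ → Supp B L φ → Supp C L φ
Supp-mono B⊑C (atom p) ⊩p        = lift (Derives-mono B⊑C (lower ⊩p))
Supp-mono B⊑C ⊤f       ⊩⊤        = ⊩⊤
Supp-mono B⊑C 𝟎        ⊩𝟎        = lift (λ p K → Derives-mono B⊑C (lower ⊩𝟎 p K))
Supp-mono B⊑C 𝟏        ⊩𝟏        = λ D C⊑D → ⊩𝟏 D (⊑-trans B⊑C C⊑D)
Supp-mono B⊑C (φ ⊸ ψ)  ⊩φ⊸ψ      = λ D C⊑D → ⊩φ⊸ψ D (⊑-trans B⊑C C⊑D)
Supp-mono B⊑C (φ ⊗ ψ)  ⊩φ⊗ψ      = λ D C⊑D → ⊩φ⊗ψ D (⊑-trans B⊑C C⊑D)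
Supp-mono B⊑C (φ & ψ)  (⊩φ , ⊩ψ) = Supp-mono B⊑C φ ⊩φ , Supp-mono B⊑C ψ ⊩ψ
Supp-mono B⊑C (φ ⊕ ψ)  ⊩φ⊕ψ      = λ D C⊑D → ⊩φ⊕ψ D (⊑-trans B⊑C C⊑D)
Supp-mono B⊑C (! φ)    ⊩!φ       = λ D C⊑D → ⊩!φ D (⊑-trans B⊑C C⊑D)

mainTheorem7 : (Atom : Set) (B : Base Atom) (L : List Atom) (Γ : List (Formula Atom)) (φ : Formula Atom) →
    Entails B L Γ φ → (C : Base Atom) → B ⊑ C → Entails C L Γ φ
mainTheorem7 Atom B L []      φ ⊩φ   C B⊑C = Supp-mono B⊑C φ ⊩φ
mainTheorem7 Atom B L (_ ∷ _) φ Γ⊩φ C B⊑C = λ D C⊑D → Γ⊩φ D (⊑-trans B⊑C C⊑D)
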